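{- Let $S_1,\dots,S_k$ be vertex-disjoint stars with centres $c_1,\dots,c_k$, let $L$ be a set of integers with $|L|=\left|\bigcup_{i=1}^k E(S_i)\right|$, and let $g:\bigcup_{i=1}^k V(S_i)\to\mathbb N$. Then there is a bijection $f:\bigcup_{i=1}^k E(S_i)\to L$ such that the sums $s_{(f,g)}(c_i)$, $1\le i\le k$, are pairwise distinct.
   Context: A star is a graph on at least $2$ vertices with a distinguished vertex $c$ (its centre) whose edges are exactly $cv$ for all other vertices $v$. For an edge labelling $f$ and vertex function $g$, $s_{(f,g)}(v)=g(v)+\sum_{e\ni v} f(e)$, the sum over labelled edges containing $v$. -}

module Defs where

open import Data.Nat using (ℕ; zero; suc; _≤_)
import Data.Nat as ℕ
open import Data.Integer using (ℤ; +_; _+_)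
open import Data.Fin using (Fin; zero; suc)
import Data.Fin as Fin
open import Data.Product using (Σ; _,_; proj₁; proj₂)
open import Data.Product.Properties using (≡-dec)
open import Relation.Nullary using (Dec; yes; no)
open import Relation.Nullary.Decidable using (⌊_⌋)
open import Data.Bool using (Bool; true; false; if_then_else_)
open import Data.List using (List)

sumℕ : (n : ℕ) → (Fin n → ℕ) → ℕ
sumℕ zero    h = 0
sumℕ (suc n) h = h zero ℕ.+ sumℕ n (λ j → h (suc j))

sumℤ : (n : ℕ) → (Fin n → ℤ) → ℤ
sumℤ zero    h = + 0
sumℤ (suc n) h = h zero + sumℤ n (λ j → h (suc j))

-- A family of k vertex-disjoint stars S_1..S_k, where star S_i has
-- m i ≥ 1 leaves (a star has at least 2 vertices).
record Stars : Set where
  field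
    k      : ℕ
    m      : Fin k → ℕ
    m≥1    : (i : Fin k) → 1 ≤ m i

module _ (S : Stars) where
  open Stars S

  data Vertex : Set where
    centre : Fin k → Vertex
    leaf   : (i : Fin k) → Fin (m i) → Vertex

  -- Edges of the union: edge (i , j) is c_i joined to the j-th leaf of S_i.
  Edge : Set
  Edge = Σ (Fin k) (λ i → Fin (m i))

  numEdges : ℕ
  numEdges = sumℕ k m

  incident : Vertex → Edge → Bool
  incident (centre i') (i , j) = ⌊ i' Fin.≟ i ⌋
  incident (leaf i' j') (i , j) = ⌊ ≡-dec Fin._≟_ Fin._≟_ (i' , j') (i , j) ⌋

  s : (Edge → ℤ) → (Vertex → ℕ) → Vertex → ℤ
  s f g v = + g v + sumℤ k (λ i → sumℤ (m i) (λ j →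
              if incident v (i , j) then f (i , j) else + 0))

-- Reserve one edge in each star and label all other edges arbitrarily with all but k of the values.
-- The centre sum of star i is then a i + σ i, where a i is already fixed and σ i is the label of the
-- reserved edge. The k leftover values are matched to the stars greedily: the star with the largest
-- a i receives the largest leftover value, so its sum exceeds all the others, and we recurse.
module Submission where

open import Defs
open import Data.Nat using (ℕ)
open import Data.Integer using (ℤ)
open import Data.Fin using (Fin)
open import Data.Product using (Σ; _×_; _,_)
open import Data.List using (List; length)
open import Data.List.Relation.Unary.Unique.Propositional using (Unique)
open import Data.List.Membership.Propositional using (_∈_)
open import Relation.Binary.PropositionalEquality using (_≡_; _≢_)
open import Function.Definitions using (Injective)

open import Data.Bool using (if_then_else_)
open import Data.Empty using (⊥-elim)
open import Data.Fin as Fin using (zero; suc; cast)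
import Data.Fin.Properties as FinP
open import Data.Integer using (+_; _+_; _≤_; _<_)
open import Data.Integer.Properties as ℤP using (≤-totalOrder; +-mono-≤-<; ≤∧≢⇒<; <⇒≢)
open import Data.List
  using ([]; _∷_; _++_; map; concat; tabulate; take; drop; allFin; foldr; lookup)
open import Data.List.Extrema ≤-totalOrder
  using (argmax; argmax-sel; f[⊥]≤f[argmax]; f[xs]≤f[argmax])
open import Data.List.Membership.Propositional.Properties
  using (∈-∃++; ∈-concat⁺′; ∈-map⁺; ∈-map⁻; ∈-tabulate⁺; ∈-allFin)
open import Data.List.Properties
  using ( map-tabulate; tabulate-cong; concat-map; take++drop≡id; length-take; length-drop
        ; length-tabulate; map-cong-local)
open import Data.List.Relation.Binary.Permutation.Propositional
  using (_↭_; ↭-refl; ↭-prep; ↭-sym; ↭-trans; ↭-reflexive; ↭⇒↭ₛ; module PermutationReasoning)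
open import Data.List.Relation.Binary.Permutation.Propositional.Properties
  using (All-resp-↭; ∈-resp-↭; map⁺; ↭-length; shift; shifts; ++⁺ˡ; ++⁺ʳ)
import Data.List.Relation.Binary.Permutation.Setoid.Properties as PermutationSetoid
open import Data.List.Relation.Unary.All as All using (All; _∷_)
open import Data.List.Relation.Unary.AllPairs using (_∷_)
open import Data.List.Relation.Unary.Any using (here; there)
open import Data.List.Relation.Unary.Unique.Propositional.Properties using (allFin⁺; take⁺)
import Data.Nat as ℕ
open import Data.Nat using (zero; suc; pred)
import Data.Nat.Properties as ℕP
open import Algebra.Properties.CommutativeSemigroup ℕP.+-commutativeSemigroup using (x∙yz≈y∙xz)
open import Algebra.Properties.CommutativeSemigroup ℤP.+-commutativeSemigroup using (x∙yz≈xz∙y)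
open import Data.Product using (proj₁; proj₂)
open import Data.Sum using (inj₁; inj₂)
open import Data.Vec.Functional using (updateAt)
open import Data.Vec.Functional.Properties using (updateAt-updates; updateAt-minimal)
open import Function using (id; const; _∘_)
open import Relation.Binary.PropositionalEquality
  using (refl; sym; trans; cong; cong₂; ≢-sym; setoid; module ≡-Reasoning)
open import Relation.Nullary using (yes; no)
open import Relation.Nullary.Decidable using (⌊_⌋)

private
  variable
    A B : Set
    n : ℕ

InjectiveOn : (A → B) → List A → Set
InjectiveOn {A} h xs = ∀ {x y : A} → x ∈ xs → y ∈ xs → h x ≡ h y → x ≡ y

Unique-resp-↭ : {xs ys : List A} → xs ↭ ys → Unique xs → Unique ys
Unique-resp-↭ {A} xs↭ys = PermutationSetoid.Unique-resp-↭ (setoid A) (↭⇒↭ₛ xs↭ys)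

∈⇒↭∷ : {x : A} {xs : List A} → x ∈ xs → Σ (List A) (λ ys → xs ↭ x ∷ ys)
∈⇒↭∷ {x = x} x∈xs with ys , zs , refl ← ∈-∃++ x∈xs = ys ++ zs , shift x ys zs

↭∷-length : {xs ys : List A} {y : A} → xs ↭ y ∷ ys → length xs ≡ suc n → length ys ≡ n
↭∷-length xs↭ ∣xs∣ = ℕP.suc-injective (trans (sym (↭-length xs↭)) ∣xs∣)

All-↭∷ : {P : A → Set} {xs ys : List A} {y : A} → xs ↭ y ∷ ys → All P xs → All P ys
All-↭∷ xs↭ = All.tail ∘ All-resp-↭ xs↭

Unique-map⇒InjectiveOn : (f : A → B) {xs : List A} → Unique (map f xs) → InjectiveOn f xs
Unique-map⇒InjectiveOn f _          (here refl) (here refl) _  = refl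
Unique-map⇒InjectiveOn f (fx≢ ∷ _)  (here refl) (there y∈) eq = ⊥-elim (All.lookup fx≢ (∈-map⁺ f y∈) eq)
Unique-map⇒InjectiveOn f (fy≢ ∷ _)  (there x∈) (here refl) eq = ⊥-elim (All.lookup fy≢ (∈-map⁺ f x∈) (sym eq))
Unique-map⇒InjectiveOn f (_ ∷ !map) (there x∈) (there y∈) eq = Unique-map⇒InjectiveOn f !map x∈ y∈ eq

map-↭⇒bijection : (f : A → B) {es : List A} {L : List B} → (∀ e → e ∈ es) → Unique L → map f es ↭ L →
                  Injective _≡_ _≡_ f × (∀ e → f e ∈ L) × (∀ y → y ∈ L → Σ A (λ e → f e ≡ y))
map-↭⇒bijection {A = A} f {es} {L} ∈es !L fes↭L = injective , into , onto
  where
  injective : Injective _≡_ _≡_ f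
  injective {x} {y} = Unique-map⇒InjectiveOn f (Unique-resp-↭ (↭-sym fes↭L) !L) (∈es x) (∈es y)

  into : ∀ e → f e ∈ L
  into e = ∈-resp-↭ fes↭L (∈-map⁺ f (∈es e))

  onto : ∀ y → y ∈ L → Σ A (λ e → f e ≡ y)
  onto y y∈L with e , _ , y≡fe ← ∈-map⁻ f (∈-resp-↭ (↭-sym fes↭L) y∈L) = e , sym y≡fe

concat-tabulate-∷ : ∀ n (x : Fin n → A) (xs : Fin n → List A) →
                    concat (tabulate (λ i → x i ∷ xs i)) ↭ tabulate x ++ concat (tabulate xs)
concat-tabulate-∷ zero    x xs = ↭-refl
concat-tabulate-∷ (suc n) x xs = ↭-prep (x zero) (↭-trans
  (++⁺ˡ (xs zero) (concat-tabulate-∷ n (x ∘ suc) (xs ∘ suc)))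
  (shifts (xs zero) (tabulate (x ∘ suc))))

tabulate-lookup-cast : (xs : List A) (eq : n ≡ length xs) → tabulate (lookup xs ∘ cast eq) ≡ xs
tabulate-lookup-cast {n = zero}  []       _  = refl
tabulate-lookup-cast {n = suc n} (x ∷ xs) eq =
  cong (x ∷_) (tabulate-lookup-cast xs (ℕP.suc-injective eq))

length-take-+ : ∀ m {r} (xs : List A) → length xs ≡ m ℕ.+ r → length (take m xs) ≡ m
length-take-+ m {r} xs ∣xs∣ =
  trans (length-take m xs) (trans (cong (m ℕ.⊓_) ∣xs∣) (ℕP.m≤n⇒m⊓n≡m (ℕP.m≤m+n m r)))

length-drop-+ : ∀ m {r} (xs : List A) → length xs ≡ m ℕ.+ r → length (drop m xs) ≡ r
length-drop-+ m {r} xs ∣xs∣ =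
  trans (length-drop m xs) (trans (cong (ℕ._∸ m) ∣xs∣) (ℕP.m+n∸m≡n m r))

chunks : ∀ n → (Fin n → ℕ) → List A → Fin n → List A
chunks (suc n) ℓ xs zero    = take (ℓ zero) xs
chunks (suc n) ℓ xs (suc i) = chunks n (ℓ ∘ suc) (drop (ℓ zero) xs) i

length-chunks : ∀ n (ℓ : Fin n → ℕ) (xs : List A) → length xs ≡ sumℕ n ℓ →
                ∀ i → length (chunks n ℓ xs i) ≡ ℓ i
length-chunks (suc n) ℓ xs ∣xs∣ zero    = length-take-+ (ℓ zero) xs ∣xs∣
length-chunks (suc n) ℓ xs ∣xs∣ (suc i) =
  length-chunks n (ℓ ∘ suc) (drop (ℓ zero) xs) (length-drop-+ (ℓ zero) xs ∣xs∣) i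

concat-chunks : ∀ n (ℓ : Fin n → ℕ) (xs : List A) → length xs ≡ sumℕ n ℓ →
                concat (tabulate (chunks n ℓ xs)) ≡ xs
concat-chunks zero    ℓ [] _    = refl
concat-chunks (suc n) ℓ xs ∣xs∣ = trans
  (cong (take (ℓ zero) xs ++_)
        (concat-chunks n (ℓ ∘ suc) (drop (ℓ zero) xs) (length-drop-+ (ℓ zero) xs ∣xs∣)))
  (take++drop≡id (ℓ zero) xs)

sumℕ-pred : ∀ n (ℓ : Fin n → ℕ) → (∀ i → 1 ℕ.≤ ℓ i) → sumℕ n ℓ ≡ n ℕ.+ sumℕ n (pred ∘ ℓ)
sumℕ-pred zero    ℓ ℓ≥1 = refl
sumℕ-pred (suc n) ℓ ℓ≥1 = begin
  ℓ zero ℕ.+ sumℕ n (ℓ ∘ suc)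
    ≡⟨ cong₂ ℕ._+_ (sym (ℕP.suc-pred (ℓ zero) {{ℕ.>-nonZero (ℓ≥1 zero)}}))
                   (sumℕ-pred n (ℓ ∘ suc) (ℓ≥1 ∘ suc)) ⟩
  suc (pred (ℓ zero)) ℕ.+ (n ℕ.+ sumℕ n (pred ∘ ℓ ∘ suc))
    ≡⟨ cong suc (x∙yz≈y∙xz (pred (ℓ zero)) n _) ⟩
  suc n ℕ.+ sumℕ (suc n) (pred ∘ ℓ) ∎
  where open ≡-Reasoning

sumᴸ : List ℤ → ℤ
sumᴸ = foldr _+_ (+ 0)

sumℤ-tabulate : ∀ n (h : Fin n → ℤ) → sumℤ n h ≡ sumᴸ (tabulate h)
sumℤ-tabulate zero    h = refl
sumℤ-tabulate (suc n) h = cong (_+_ (h zero)) (sumℤ-tabulate n (h ∘ suc))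

sumℤ-zero : ∀ n (h : Fin n → ℤ) → (∀ j → h j ≡ + 0) → sumℤ n h ≡ + 0
sumℤ-zero zero    h h≡0 = refl
sumℤ-zero (suc n) h h≡0 = cong₂ _+_ (h≡0 zero) (sumℤ-zero n (h ∘ suc) (h≡0 ∘ suc))

sumℤ-single : ∀ n (h : Fin n → ℤ) i → (∀ j → i ≢ j → h j ≡ + 0) → sumℤ n h ≡ h i
sumℤ-single (suc n) h zero    h≡0 = begin
  h zero + sumℤ n (h ∘ suc)  ≡⟨ cong (_+_ (h zero)) (sumℤ-zero n (h ∘ suc) (λ j → h≡0 (suc j) λ ())) ⟩
  h zero + + 0               ≡⟨ ℤP.+-identityʳ (h zero) ⟩
  h zero                     ∎
  where open ≡-Reasoning
sumℤ-single (suc n) h (suc i) h≡0 = begin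
  h zero + sumℤ n (h ∘ suc)  ≡⟨ cong₂ _+_ (h≡0 zero λ ()) (sumℤ-single n (h ∘ suc) i h∘suc≡0) ⟩
  + 0 + h (suc i)            ≡⟨ ℤP.+-identityˡ (h (suc i)) ⟩
  h (suc i)                  ∎
  where
  open ≡-Reasoning
  h∘suc≡0 : ∀ j → i ≢ j → h (suc j) ≡ + 0
  h∘suc≡0 j i≢j = h≡0 (suc j) (i≢j ∘ FinP.suc-injective)

argmax-∈ : (f : A → ℤ) (x : A) (xs : List A) → argmax f x xs ∈ x ∷ xs
argmax-∈ f x xs with argmax-sel f x xs
... | inj₁ eq = here eq
... | inj₂ m  = there m

argmax-maximal : (f : A → ℤ) (x : A) (xs : List A) → All (λ y → f y ≤ f (argmax f x xs)) (x ∷ xs)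
argmax-maximal f x xs = f[⊥]≤f[argmax] {f = f} x xs ∷ f[xs]≤f[argmax] {f = f} x xs

DistinctSumMatching : {k : ℕ} → (Fin k → ℤ) → List (Fin k) → List ℤ → Set
DistinctSumMatching {k} a I M = Σ (Fin k → ℤ) λ σ → map σ I ↭ M × InjectiveOn (λ i → a i + σ i) I

distinctSumMatching-resp-↭ : {k : ℕ} {a : Fin k → ℤ} {I I′ : List (Fin k)} {M M′ : List ℤ} →
                             I ↭ I′ → M ↭ M′ → DistinctSumMatching a I′ M′ → DistinctSumMatching a I M
distinctSumMatching-resp-↭ I↭I′ M↭M′ (σ , σI′↭M′ , σ-inj) =
  σ , ↭-trans (map⁺ σ I↭I′) (↭-trans σI′↭M′ (↭-sym M↭M′)) ,
  λ i∈I j∈I → σ-inj (∈-resp-↭ I↭I′ i∈I) (∈-resp-↭ I↭I′ j∈I)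

distinctSumMatching-∷ : {k : ℕ} (a : Fin k → ℤ) {p : Fin k} {x : ℤ} {I : List (Fin k)} {M : List ℤ} →
                        All (p ≢_) I → All (λ i → a i ≤ a p) I → All (x ≢_) M → All (_≤ x) M →
                        DistinctSumMatching a I M → DistinctSumMatching a (p ∷ I) (x ∷ M)
distinctSumMatching-∷ {k} a {p} {x} {I} {M} p≢I a≤ap x≢M M≤x (σ , σI↭M , σ-inj) =
  σ′ , σ′↭ , σ′-inj
  where
  σ′ : Fin k → ℤ
  σ′ = updateAt σ p (const x)

  σ′p≡x : σ′ p ≡ x
  σ′p≡x = updateAt-updates p σ

  σ′≡σ : All (λ i → σ′ i ≡ σ i) I
  σ′≡σ = All.map (λ p≢i → updateAt-minimal _ p σ (≢-sym p≢i)) p≢I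

  σ′↭ : map σ′ (p ∷ I) ↭ x ∷ M
  σ′↭ = ↭-trans (↭-reflexive (cong₂ _∷_ σ′p≡x (map-cong-local σ′≡σ))) (↭-prep x σI↭M)

  dominated : ∀ {i} → i ∈ I → a i + σ′ i < a p + σ′ p
  dominated {i} i∈I = begin-strict
    a i + σ′ i ≡⟨ cong (_+_ (a i)) (All.lookup σ′≡σ i∈I) ⟩
    a i + σ i  <⟨ +-mono-≤-< (All.lookup a≤ap i∈I) σi<x ⟩
    a p + x    ≡⟨ cong (_+_ (a p)) σ′p≡x ⟨
    a p + σ′ p ∎
    where
    open ℤP.≤-Reasoning
    σi∈M : σ i ∈ M
    σi∈M = ∈-resp-↭ σI↭M (∈-map⁺ σ i∈I)
    σi<x : σ i < x
    σi<x = ≤∧≢⇒< (All.lookup M≤x σi∈M) (≢-sym (All.lookup x≢M σi∈M))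

  σ′-inj : InjectiveOn (λ i → a i + σ′ i) (p ∷ I)
  σ′-inj (here refl) (here refl) _  = refl
  σ′-inj (here refl) (there j∈I) eq = ⊥-elim (<⇒≢ (dominated j∈I) (sym eq))
  σ′-inj (there i∈I) (here refl) eq = ⊥-elim (<⇒≢ (dominated i∈I) eq)
  σ′-inj {i} {j} (there i∈I) (there j∈I) eq = σ-inj i∈I j∈I (begin
    a i + σ i  ≡⟨ cong (_+_ (a i)) (All.lookup σ′≡σ i∈I) ⟨
    a i + σ′ i ≡⟨ eq ⟩
    a j + σ′ j ≡⟨ cong (_+_ (a j)) (All.lookup σ′≡σ j∈I) ⟩
    a j + σ j  ∎)
    where open ≡-Reasoning

distinctSumMatching : {k : ℕ} → ∀ n (a : Fin k → ℤ) {I : List (Fin k)} {M : List ℤ} →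
                      length I ≡ n → length M ≡ n → Unique I → Unique M → DistinctSumMatching a I M
distinctSumMatching zero    a {[]}      {[]}      _   _   _  _  = const (+ 0) , ↭-refl , λ ()
distinctSumMatching (suc n) a {i₀ ∷ I₀} {x₀ ∷ M₀} ∣I∣ ∣M∣ !I !M
  with I′ , I↭ ← ∈⇒↭∷ (argmax-∈ a i₀ I₀) | M′ , M↭ ← ∈⇒↭∷ (argmax-∈ id x₀ M₀)
  with p≢I′ ∷ !I′ ← Unique-resp-↭ I↭ !I | x≢M′ ∷ !M′ ← Unique-resp-↭ M↭ !M
  = distinctSumMatching-resp-↭ {a = a} I↭ M↭
      (distinctSumMatching-∷ a
        p≢I′ (All-↭∷ I↭ (argmax-maximal a i₀ I₀))
        x≢M′ (All-↭∷ M↭ (argmax-maximal id x₀ M₀))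
        (distinctSumMatching n a (↭∷-length I↭ ∣I∣) (↭∷-length M↭ ∣M∣) !I′ !M′))

module _ (S : Stars) where
  open Stars S

  allEdges : List (Edge S)
  allEdges = concat (tabulate λ i → tabulate (i ,_))

  ∈-allEdges : ∀ e → e ∈ allEdges
  ∈-allEdges (i , j) = ∈-concat⁺′ (∈-tabulate⁺ j) (∈-tabulate⁺ i)

  map-allEdges : (f : Edge S → A) → map f allEdges ≡ concat (tabulate λ i → tabulate λ j → f (i , j))
  map-allEdges f = begin
    map f (concat rows)                               ≡⟨ concat-map rows ⟨
    concat (map (map f) rows)                         ≡⟨ cong concat (map-tabulate (λ i → tabulate (i ,_)) (map f)) ⟩
    concat (tabulate λ i → map f (tabulate (i ,_)))   ≡⟨ cong concat (tabulate-cong λ i → map-tabulate (i ,_) f) ⟩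
    concat (tabulate λ i → tabulate λ j → f (i , j))  ∎
    where
    open ≡-Reasoning
    rows : List (List (Edge S))
    rows = tabulate λ i → tabulate (i ,_)

  s-centre : (f : Edge S → ℤ) (g : Vertex S → ℕ) (i : Fin k) →
             s S f g (centre i) ≡ + g (centre i) + sumℤ (m i) (λ j → f (i , j))
  s-centre f g i = cong (_+_ (+ g (centre i))) (trans (sumℤ-single k _ i other-star) same-star)
    where
    other-star : ∀ i′ → i ≢ i′ →
                 sumℤ (m i′) (λ j → if ⌊ i Fin.≟ i′ ⌋ then f (i′ , j) else + 0) ≡ + 0
    other-star i′ i≢i′ with i Fin.≟ i′
    ... | yes i≡i′ = ⊥-elim (i≢i′ i≡i′)
    ... | no _     = sumℤ-zero (m i′) _ (λ _ → refl)

    same-star : sumℤ (m i) (λ j → if ⌊ i Fin.≟ i ⌋ then f (i , j) else + 0) ≡ sumℤ (m i) (λ j → f (i , j))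
    same-star with i Fin.≟ i
    ... | yes _  = refl
    ... | no i≢i = ⊥-elim (i≢i refl)

-- Edge (i , 0) carries the reserved label σ i ∈ take k L; the other edges of star i carry the i-th
-- block of drop k L.
module ReservedLabelling (S : Stars) (L : List ℤ) (!L : Unique L) (∣L∣ : length L ≡ numEdges S)
                         (g : Vertex S → ℕ) where
  open Stars S

  ∣L∣-split : length L ≡ k ℕ.+ sumℕ k (pred ∘ m)
  ∣L∣-split = trans ∣L∣ (sumℕ-pred k m m≥1)

  otherLabels : Fin k → List ℤ
  otherLabels = chunks k (pred ∘ m) (drop k L)

  a : Fin k → ℤ
  a i = + g (centre i) + sumᴸ (otherLabels i)

  matching : DistinctSumMatching a (allFin k) (take k L)
  matching = distinctSumMatching k a (length-tabulate id) (length-take-+ k L ∣L∣-split)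
                                     (allFin⁺ k) (take⁺ k !L)

  σ : Fin k → ℤ
  σ = proj₁ matching

  labels : Fin k → List ℤ
  labels i = σ i ∷ otherLabels i

  length-labels : ∀ i → m i ≡ length (labels i)
  length-labels i = trans (sym (ℕP.suc-pred (m i) {{ℕ.>-nonZero (m≥1 i)}}))
    (cong suc (sym (length-chunks k (pred ∘ m) (drop k L) (length-drop-+ k L ∣L∣-split) i)))

  f : Edge S → ℤ
  f (i , j) = lookup (labels i) (cast (length-labels i) j)

  tabulate-f : ∀ i → tabulate (λ j → f (i , j)) ≡ labels i
  tabulate-f i = tabulate-lookup-cast (labels i) (length-labels i)

  map-f↭L : map f (allEdges S) ↭ L
  map-f↭L = begin
    map f (allEdges S)                                ≡⟨ map-allEdges S f ⟩
    concat (tabulate λ i → tabulate λ j → f (i , j))  ≡⟨ cong concat (tabulate-cong tabulate-f) ⟩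
    concat (tabulate labels)                          ↭⟨ concat-tabulate-∷ k σ otherLabels ⟩
    tabulate σ ++ concat (tabulate otherLabels)       ≡⟨ cong₂ _++_ (sym (map-tabulate id σ)) concat-otherLabels ⟩
    map σ (allFin k) ++ drop k L                      ↭⟨ ++⁺ʳ (drop k L) (proj₁ (proj₂ matching)) ⟩
    take k L ++ drop k L                              ≡⟨ take++drop≡id k L ⟩
    L                                                 ∎
    where
    open PermutationReasoning
    concat-otherLabels : concat (tabulate otherLabels) ≡ drop k L
    concat-otherLabels = concat-chunks k (pred ∘ m) (drop k L) (length-drop-+ k L ∣L∣-split)

  s-centre-f : ∀ i → s S f g (centre i) ≡ a i + σ i
  s-centre-f i = begin
    s S f g (centre i)                             ≡⟨ s-centre S f g i ⟩
    + g (centre i) + sumℤ (m i) (λ j → f (i , j))  ≡⟨ cong (_+_ (+ g (centre i))) sum-row ⟩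
    + g (centre i) + (σ i + sumᴸ (otherLabels i))  ≡⟨ x∙yz≈xz∙y (+ g (centre i)) (σ i) _ ⟩
    a i + σ i                                      ∎
    where
    open ≡-Reasoning
    sum-row : sumℤ (m i) (λ j → f (i , j)) ≡ σ i + sumᴸ (otherLabels i)
    sum-row = trans (sumℤ-tabulate (m i) _) (cong sumᴸ (tabulate-f i))

  centres-distinct : ∀ i i′ → i ≢ i′ → s S f g (centre i) ≢ s S f g (centre i′)
  centres-distinct i i′ i≢i′ eq = i≢i′ (proj₂ (proj₂ matching) (∈-allFin i) (∈-allFin i′)
    (trans (sym (s-centre-f i)) (trans eq (s-centre-f i′))))

lemma19 : (S : Stars) → (L : List ℤ) → Unique L → length L ≡ numEdges S →
          (g : Vertex S → ℕ) →
          Σ (Edge S → ℤ) (λ f →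
            (Injective _≡_ _≡_ f × (∀ e → f e ∈ L) × (∀ x → x ∈ L → Σ (Edge S) (λ e → f e ≡ x)))
            × (∀ (i i′ : Fin (Stars.k S)) → i ≢ i′ →
                 s S f g (centre i) ≢ s S f g (centre i′)))
lemma19 S L !L ∣L∣ g = f , map-↭⇒bijection f (∈-allEdges S) !L map-f↭L , centres-distinct
  where open ReservedLabelling S L !L ∣L∣ g
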